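{- Let $B_n=\{2\}\cup\{m \text{ odd}: 3\le m\le n-3+p_n\}$, where $p_n=n\bmod 2$. Then $|D_{[n]}(B_n)|\in\Omega\!\left(\left(\sqrt{2+2\sqrt2}\right)^n\right)$, i.e. there is a constant $c>0$ such that $|D_{[n]}(B_n)|\ge c\left(\sqrt{2+2\sqrt2}\right)^n$ for all sufficiently large $n$.
   Context: The set of alternatives is $[n]=\{1,\dots,n\}$ with its natural order. For a triple $i<j<k$, the never condition $1N3$ on a set of linear orders means that in every order, $i$ is not ranked last among $i,j,k$; $3N1$ means that $k$ is not ranked first among $i,j,k$. For $B\subseteq[n]$, $D_{[n]}(B)$ is the set of all linear orders on $[n]$ such that every triple $i<j<k$ satisfies $1N3$ if $j\in B$ and $3N1$ if $j\notin B$. The set $B_n=\{2,3,5,\dots,n-3+p_n\}$ defines the odd $1N33N1$-alternating scheme. -}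

module Defs where

open import Data.Nat using (ℕ; zero; suc; _+_; _*_; _∸_; _≤_; _<_; _%_)
open import Data.Nat.Properties using ()
open import Data.Fin using (Fin; toℕ)
open import Data.Vec using (Vec; lookup)
open import Data.Product using (_×_; _,_; ∃; Σ)
open import Data.Sum using (_⊎_)
open import Relation.Nullary using (¬_)
open import Relation.Binary.PropositionalEquality using (_≡_)

-- Membership in B_n = {2} ∪ {m odd : 3 ≤ m ≤ n - 3 + p_n},  p_n = n mod 2.
-- (Natural subtraction: for n < 3 the odd part is empty, as it should be.)
InB : ℕ → ℕ → Set
InB n m = m ≡ 2 ⊎ (m % 2 ≡ 1 × 3 ≤ m × m ≤ (n ∸ 3) + (n % 2))

-- A linear order on [n] is encoded by an injective rank vector:
-- alternative i (i : Fin n stands for the alternative toℕ i + 1) has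
-- position lookup r i; smaller position = ranked higher.
LinearOrder : (n : ℕ) → Vec (Fin n) n → Set
LinearOrder n r = ∀ (i j : Fin n) → lookup r i ≡ lookup r j → i ≡ j

Above : {n : ℕ} → Vec (Fin n) n → Fin n → Fin n → Set
Above r x y = toℕ (lookup r x) < toℕ (lookup r y)

OneN3 : {n : ℕ} → Vec (Fin n) n → Fin n → Fin n → Fin n → Set
OneN3 r i j k = ¬ (Above r j i × Above r k i)

ThreeN1 : {n : ℕ} → Vec (Fin n) n → Fin n → Fin n → Fin n → Set
ThreeN1 r i j k = ¬ (Above r k i × Above r k j)

-- r ∈ D_{[n]}(B) where B is given as a predicate on labels 1..n
InD : (n : ℕ) → (ℕ → Set) → Vec (Fin n) n → Set
InD n B r = LinearOrder n r ×
  (∀ (i j k : Fin n) → toℕ i < toℕ j → toℕ j < toℕ k →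
     (B (suc (toℕ j)) → OneN3 r i j k) × (¬ B (suc (toℕ j)) → ThreeN1 r i j k))

AtLeast : (n : ℕ) → (ℕ → Set) → ℕ → Set
AtLeast n B K = Σ (Fin K → Vec (Fin n) n) λ f →
  (∀ a b → f a ≡ f b → a ≡ b) × (∀ a → InD n B (f a))

-- (2 + 2√2)^n = fst (pow n) + snd (pow n) · √2
pow : ℕ → ℕ × ℕ
pow zero = 1 , 0
pow (suc n) with pow n
... | a , b = 2 * a + 4 * b , 2 * a + 2 * b

-- a + b√2 ≤ X  (all naturals), decided exactly: a ≤ X and 2b² ≤ (X - a)²
LeSqrt2 : ℕ → ℕ → ℕ → Set
LeSqrt2 a b X = a ≤ X × 2 * (b * b) ≤ (X ∸ a) * (X ∸ a)

-- With c = p / q (p,q ≥ 1) and α = √(2+2√2):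
-- c · α^n ≤ K  ⇔  p² (2+2√2)^n ≤ q² K²
BoundHolds : ℕ → ℕ → ℕ → ℕ → Set
BoundHolds p q n K with pow n
... | a , b = LeSqrt2 (p * p * a) (p * p * b) (q * q * (K * K))

-- Rankings of 2k + 1 alternatives are grown two alternatives at a time: alternative 2k + 2, which for
-- k ≥ 1 is not in B, and then 2k + 3, which is, are inserted at admissible slots near the bottom.
-- Recording with each ranking the number m of admissible slots above its lowest one, the states of
-- the children of a ranking depend on its state only, so the states evolve under a linear transfer
-- operator. Its eigenfunction f + √2 g for the eigenvalue 2 + 2√2 is explicit, hence the f-weight of
-- level k is a_k, where (2 + 2√2)^k = a_k + b_k √2. States j ≥ 2 occur at least twice as often as
-- states j + 1 while f grows only like √2^j, so this weight is at most 24 times the number of rankings.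
-- An even number of alternatives is reached by appending the last one at the bottom, and
-- (2 + 2√2)^n ≤ 252 a_k² for n ≤ 2k + 2 then gives the bound with constant 1/384.
module Submission where

open import Data.Nat
  using (ℕ; zero; suc; pred; _+_; _*_; _∸_; _≤_; _<_; _%_; z≤n; s≤s; s≤s⁻¹; s<s⁻¹; z<s; _≟_; _<?_)
open import Data.Nat.Properties
open import Data.Nat.DivMod using (m*n%n≡0; [m+kn]%n≡m%n)
open import Data.Nat.ListAction using (sum)
open import Data.Nat.ListAction.Properties using (sum-++)
open import Data.Nat.Tactic.RingSolver using (solve-∀)
open import Data.Product using (_×_; _,_; proj₁; proj₂; ∃; Σ)
open import Data.Sum using (_⊎_; inj₁; inj₂)
open import Data.Empty using (⊥-elim)
open import Data.Unit using (tt)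
open import Data.Fin using (Fin; toℕ; fromℕ<)
import Data.Fin as Fin
open import Data.Fin.Properties using (toℕ-fromℕ<; toℕ-injective; toℕ<n)
open import Data.Vec using (Vec; lookup; tabulate)
open import Data.Vec.Properties using (lookup∘tabulate)
open import Data.List using (List; []; _∷_; _++_; [_]; map; concat; concatMap; applyUpTo; length)
import Data.List as List
open import Data.List.Properties
  using ( length-map; map-++; concat-++; ++-identityʳ; applyUpTo-∷ʳ; map-applyUpTo
        ; map-concatMap; concatMap-map; concatMap-cong)
open import Data.List.Membership.Propositional.Properties using (∈-lookup)
open import Data.List.Relation.Unary.All as All using (All; []; _∷_)
import Data.List.Relation.Unary.All.Properties as All
open import Data.List.Relation.Unary.AllPairs as AllPairs using (AllPairs; []; _∷_)
import Data.List.Relation.Unary.AllPairs.Properties as AllPairs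
open import Algebra.Properties.CommutativeSemigroup +-commutativeSemigroup
  using () renaming (interchange to +-interchange)
open import Algebra.Properties.CommutativeSemigroup *-commutativeSemigroup
  using () renaming (interchange to *-interchange)
open import Function using (_on_; _∘_)
open import Relation.Nullary using (¬_; yes; no; contradiction)
open import Relation.Binary using (tri<; tri≈; tri>)
open import Relation.Binary.PropositionalEquality hiding ([_])
open import Defs

-- Rankings and insertion

-- ρ x is the position of alternative x (0 = top); only alternatives and positions below n matter.
Ranking : Set
Ranking = ℕ → ℕ

shift : ℕ → ℕ → ℕ
shift p v with v <? p
... | yes _ = v
... | no  _ = suc v

shift-below : ∀ {p v} → v < p → shift p v ≡ v
shift-below {p} {v} v<p with v <? p
... | yes _ = refl
... | no v≮p = contradiction v<p v≮p

shift-mono-< : ∀ p {a b} → a < b → shift p a < shift p b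
shift-mono-< p {a} {b} a<b with a <? p | b <? p
... | yes _   | yes _   = a<b
... | yes _   | no  _   = m<n⇒m<1+n a<b
... | no  a≮p | yes b<p = contradiction (<-trans a<b b<p) a≮p
... | no  _   | no  _   = s≤s a<b

shift-cancel-< : ∀ p {a b} → shift p a < shift p b → a < b
shift-cancel-< p {a} {b} lt with a <? p | b <? p
... | yes _   | yes _   = lt
... | yes a<p | no  b≮p = <-≤-trans a<p (≮⇒≥ b≮p)
... | no  _   | yes _   = <-trans (n<1+n a) lt
... | no  _   | no  _   = s<s⁻¹ lt

shift-injective : ∀ p {a b} → shift p a ≡ shift p b → a ≡ b
shift-injective p {a} {b} eq with <-cmp a b
... | tri< a<b _ _ = contradiction eq (<⇒≢ (shift-mono-< p a<b))
... | tri≈ _ a≡b _ = a≡b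
... | tri> _ _ b<a = contradiction (sym eq) (<⇒≢ (shift-mono-< p b<a))

shift-≢ : ∀ p v → shift p v ≢ p
shift-≢ p v with v <? p
... | yes v<p = <⇒≢ v<p
... | no  v≮p = λ eq → v≮p (subst (v <_) eq (n<1+n v))

shift-≤-suc : ∀ p v → shift p v ≤ suc v
shift-≤-suc p v with v <? p
... | yes _ = n≤1+n v
... | no  _ = ≤-refl

suc≤shift⇒≤ : ∀ {p q v} → p ≤ q → suc q ≤ shift p v → q ≤ v
suc≤shift⇒≤ {p} {q} {v} p≤q le with v <? p
... | yes v<p = ⊥-elim (<-asym (<-≤-trans v<p p≤q) le)
... | no  _   = s≤s⁻¹ le

insert : ℕ → Ranking → ℕ → Ranking
insert n ρ p x with x ≟ n
... | yes _ = p
... | no  _ = shift p (ρ x)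

insert-new : ∀ n ρ p → insert n ρ p n ≡ p
insert-new n ρ p with n ≟ n
... | yes _   = refl
... | no  n≢n = contradiction refl n≢n

insert-old : ∀ {n} ρ p {x} → x < n → insert n ρ p x ≡ shift p (ρ x)
insert-old {n} ρ p {x} x<n with x ≟ n
... | yes x≡n = contradiction x≡n (<⇒≢ x<n)
... | no  _   = refl

OneN3ʳ : Ranking → ℕ → ℕ → ℕ → Set
OneN3ʳ ρ i j k = ¬ (ρ j < ρ i × ρ k < ρ i)

ThreeN1ʳ : Ranking → ℕ → ℕ → ℕ → Set
ThreeN1ʳ ρ i j k = ¬ (ρ k < ρ i × ρ k < ρ j)

-- Alternatives are 0-indexed here, while the scheme B speaks about labels 1..n.
record Triple (B : ℕ → Set) (ρ : Ranking) (i j k : ℕ) : Set where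
  constructor triple
  field
    oneN3   : B (suc j) → OneN3ʳ ρ i j k
    threeN1 : ¬ B (suc j) → ThreeN1ʳ ρ i j k

record Admissible (B : ℕ → Set) (n : ℕ) (ρ : Ranking) : Set where
  field
    injective : ∀ {x y} → x < n → y < n → ρ x ≡ ρ y → x ≡ y
    bounded   : ∀ {x} → x < n → ρ x < n
    triples   : ∀ {i j k} → i < j → j < k → k < n → Triple B ρ i j k

-- The triple conditions on (i, j, new) when the new alternative is put at slot p,
-- i.e. directly above every alternative at a position ≥ p.
record SlotTriple (B : ℕ → Set) (ρ : Ranking) (p i j : ℕ) : Set where
  constructor slotTriple
  field
    oneN3   : B (suc j) → ¬ (ρ j < ρ i × p ≤ ρ i)
    threeN1 : ¬ B (suc j) → ¬ (p ≤ ρ i × p ≤ ρ j)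

AdmissibleSlot : (ℕ → Set) → ℕ → Ranking → ℕ → Set
AdmissibleSlot B n ρ p = ∀ {i j} → i < j → j < n → SlotTriple B ρ p i j

insert-reflects-< : ∀ {n} ρ p {a b} → a < n → b < n → insert n ρ p a < insert n ρ p b → ρ a < ρ b
insert-reflects-< ρ p a<n b<n lt =
  shift-cancel-< p (subst₂ _<_ (insert-old ρ p a<n) (insert-old ρ p b<n) lt)

insert-reflects-slot : ∀ {n} ρ {p q a} → p ≤ q → a < n → suc q ≤ insert n ρ p a → q ≤ ρ a
insert-reflects-slot ρ {p} p≤q a<n le = suc≤shift⇒≤ p≤q (subst (_ ≤_) (insert-old ρ p a<n) le)

insert-new-< : ∀ {n} ρ p {a} → a < n → insert n ρ p n < insert n ρ p a → p ≤ ρ a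
insert-new-< {n} ρ p {a} a<n lt =
  insert-reflects-slot ρ ≤-refl a<n (subst (_< insert n ρ p a) (insert-new n ρ p) lt)

triple-insert-old : ∀ {B n i j k} ρ p → i < n → j < n → k < n →
  Triple B ρ i j k → Triple B (insert n ρ p) i j k
triple-insert-old ρ p i<n j<n k<n (triple one three) = triple
  (λ b (ji , ki) → one b (insert-reflects-< ρ p j<n i<n ji , insert-reflects-< ρ p k<n i<n ki))
  (λ b (ki , kj) → three b (insert-reflects-< ρ p k<n i<n ki , insert-reflects-< ρ p k<n j<n kj))

triple-insert-new : ∀ {B n i j} ρ p → i < n → j < n →
  SlotTriple B ρ p i j → Triple B (insert n ρ p) i j n
triple-insert-new ρ p i<n j<n (slotTriple one three) = triple
  (λ b (ji , ni) → one b (insert-reflects-< ρ p j<n i<n ji , insert-new-< ρ p i<n ni))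
  (λ b (ni , nj) → three b (insert-new-< ρ p i<n ni , insert-new-< ρ p j<n nj))

insert-admissible : ∀ {B n ρ p} → Admissible B n ρ → p ≤ n → AdmissibleSlot B n ρ p →
  Admissible B (suc n) (insert n ρ p)
insert-admissible {B} {n} {ρ} {p} adm p≤n slot = record
  { injective = injective′ ; bounded = bounded′ ; triples = triples′ }
  where
  open Admissible adm
  injective′ : ∀ {x y} → x < suc n → y < suc n → insert n ρ p x ≡ insert n ρ p y → x ≡ y
  injective′ {x} {y} x<1+n y<1+n eq with m<1+n⇒m<n∨m≡n x<1+n | m<1+n⇒m<n∨m≡n y<1+n
  ... | inj₁ x<n  | inj₁ y<n  = injective x<n y<n (shift-injective p
          (trans (sym (insert-old ρ p x<n)) (trans eq (insert-old ρ p y<n))))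
  ... | inj₁ x<n  | inj₂ refl = contradiction
          (trans (sym (insert-old ρ p x<n)) (trans eq (insert-new n ρ p))) (shift-≢ p (ρ x))
  ... | inj₂ refl | inj₁ y<n  = contradiction
          (trans (sym (insert-old ρ p y<n)) (trans (sym eq) (insert-new n ρ p))) (shift-≢ p (ρ y))
  ... | inj₂ refl | inj₂ refl = refl
  bounded′ : ∀ {x} → x < suc n → insert n ρ p x < suc n
  bounded′ {x} x<1+n with m<1+n⇒m<n∨m≡n x<1+n
  ... | inj₁ x<n rewrite insert-old ρ p x<n = ≤-<-trans (shift-≤-suc p (ρ x)) (s≤s (bounded x<n))
  ... | inj₂ refl rewrite insert-new n ρ p = s≤s p≤n
  triples′ : ∀ {i j k} → i < j → j < k → k < suc n → Triple B (insert n ρ p) i j k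
  triples′ {j = j} i<j j<k k<1+n with m<1+n⇒m<n∨m≡n k<1+n
  ... | inj₁ k<n  = triple-insert-old ρ p (<-trans i<j j<n) j<n k<n (triples i<j j<k k<n)
    where
    j<n : j < n
    j<n = <-trans j<k k<n
  ... | inj₂ refl = triple-insert-new ρ p (<-trans i<j j<k) j<k (slot i<j j<k)

lowSlot-admissible : ∀ {B n ρ p} → (∀ {i} → suc i < n → ρ i < p) → AdmissibleSlot B n ρ p
lowSlot-admissible low i<j j<n =
  slotTriple (λ _ (_ , p≤ρi) → <⇒≱ (low (≤-<-trans i<j j<n)) p≤ρi)
             (λ _ (p≤ρi , _) → <⇒≱ (low (≤-<-trans i<j j<n)) p≤ρi)

bottomSlot-admissible : ∀ {B n ρ} → Admissible B n ρ → AdmissibleSlot B n ρ n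
bottomSlot-admissible adm = lowSlot-admissible (λ 1+i<n → Admissible.bounded adm (<-trans (n<1+n _) 1+i<n))

slot-insertAbove : ∀ {B n ρ p q} → ¬ B (suc n) → p ≤ q → AdmissibleSlot B n ρ q →
  AdmissibleSlot B (suc n) (insert n ρ p) (suc q)
slot-insertAbove {n = n} {ρ} {p} {q} ¬b p≤q slot {i} {j} i<j j<1+n with m<1+n⇒m<n∨m≡n j<1+n
... | inj₁ j<n = slotTriple
  (λ b (ji , qi) → one b (insert-reflects-< ρ p j<n i<n ji , insert-reflects-slot ρ p≤q i<n qi))
  (λ b (qi , qj) → three b (insert-reflects-slot ρ p≤q i<n qi , insert-reflects-slot ρ p≤q j<n qj))
  where
  i<n : i < n
  i<n = <-trans i<j j<n
  open SlotTriple (slot i<j j<n) renaming (oneN3 to one; threeN1 to three)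
... | inj₂ refl = slotTriple (λ b → contradiction b ¬b)
  (λ _ (_ , q<ρn) → <⇒≱ (s≤s p≤q) (subst (suc q ≤_) (insert-new n ρ p) q<ρn))

insertBottom-old : ∀ {n ρ x} → (∀ {y} → y < n → ρ y < n) → x < n → insert n ρ n x ≡ ρ x
insertBottom-old {ρ = ρ} bounded x<n = trans (insert-old ρ _ x<n) (shift-below (bounded x<n))

slot-insertBottom : ∀ {B n ρ q} → B (suc n) → (∀ {x} → x < n → ρ x < n) → AdmissibleSlot B n ρ q →
  AdmissibleSlot B (suc n) (insert n ρ n) q
slot-insertBottom {n = n} {ρ} {q} b bounded slot {i} {j} i<j j<1+n with m<1+n⇒m<n∨m≡n j<1+n
... | inj₁ j<n = slotTriple
  (λ b (ji , qi) → one b (subst₂ _<_ (old j<n) (old i<n) ji , subst (q ≤_) (old i<n) qi))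
  (λ b (qi , qj) → three b (subst (q ≤_) (old i<n) qi , subst (q ≤_) (old j<n) qj))
  where
  i<n : i < n
  i<n = <-trans i<j j<n
  old : ∀ {x} → x < n → insert n ρ n x ≡ ρ x
  old = insertBottom-old bounded
  open SlotTriple (slot i<j j<n) renaming (oneN3 to one; threeN1 to three)
... | inj₂ refl = slotTriple
  (λ _ (n<ρi , _) → <-asym (subst₂ _<_ (insert-new n ρ n) (insertBottom-old bounded i<j) n<ρi) (bounded i<j))
  (λ ¬b → contradiction b ¬b)

-- The family of rankings

-- A node (ρ , m) on n alternatives is valid when the m + 1 lowest slots n, n - 1, …, n - m are
-- admissible (ValidNode). Its child (t , u) puts alternative n at slot n - t (t ≤ m) and then
-- alternative n + 1 at slot n + 1 - u (u ≤ width t); width and nextState count the admissible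
-- bottom slots this leaves (firstInsert-valid, secondInsert-valid).
Node : Set
Node = Ranking × ℕ

width : ℕ → ℕ
width zero    = 1
width (suc t) = suc t

nextState : ℕ → ℕ → ℕ
nextState zero    s = suc s
nextState (suc _) _ = 0

child : ℕ → Ranking → ℕ → ℕ → Node
child n ρ t u = insert (suc n) (insert n ρ (n ∸ t)) (suc n ∸ u) , nextState u (width t)

block : ℕ → Ranking → ℕ → List Node
block n ρ t = applyUpTo (child n ρ t) (suc (width t))

children : ℕ → Node → List Node
children n (ρ , m) = concat (applyUpTo (block n ρ) (suc m))

family : ℕ → List Node
family zero    = ((λ _ → 0) , 0) ∷ []
family (suc k) = concatMap (children (suc (k * 2))) (family k)

BottomSlots : (ℕ → Set) → ℕ → Ranking → ℕ → Set
BottomSlots B n ρ m = ∀ {u} → u ≤ m → AdmissibleSlot B n ρ (n ∸ u)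

ValidNode : (ℕ → Set) → ℕ → Node → Set
ValidNode B n (ρ , m) = Admissible B n ρ × BottomSlots B n ρ m × m < n

insertAt-admissible : ∀ {B n ρ m t} → ValidNode B n (ρ , m) → t ≤ m →
  Admissible B (suc n) (insert n ρ (n ∸ t))
insertAt-admissible {n = n} {t = t} (adm , slots , _) t≤m = insert-admissible adm (m∸n≤m n t) (slots t≤m)

firstInsert-valid : ∀ {B n ρ m t} → ValidNode B n (ρ , m) → t ≤ m → (0 < t → ¬ B (suc n)) →
  ValidNode B (suc n) (insert n ρ (n ∸ t) , width t)
firstInsert-valid {B} {n} {ρ} {t = zero} v@(adm , _ , m<n) _ _ =
  adm₁ , slots₁ , s≤s (≤-<-trans z≤n m<n)
  where
  adm₁ : Admissible B (suc n) (insert n ρ n)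
  adm₁ = insertAt-admissible v z≤n
  below : ∀ {i} → suc i < suc n → insert n ρ n i < n
  below 1+i<1+n = subst (_< n) (sym (insertBottom-old (Admissible.bounded adm) (s≤s⁻¹ 1+i<1+n)))
                        (Admissible.bounded adm (s≤s⁻¹ 1+i<1+n))
  slots₁ : BottomSlots B (suc n) (insert n ρ n) 1
  slots₁ {zero}        _ = bottomSlot-admissible adm₁
  slots₁ {suc zero}    _ = lowSlot-admissible below
  slots₁ {suc (suc _)} (s≤s ())
firstInsert-valid {B} {n} {ρ} {t = suc t} v@(_ , slots , m<n) t≤m ¬b =
  insertAt-admissible v t≤m , slots₁ , s≤s t≤n
  where
  t≤n : suc t ≤ n
  t≤n = ≤-trans t≤m (<⇒≤ m<n)
  slots₁ : BottomSlots B (suc n) (insert n ρ (n ∸ suc t)) (suc t)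
  slots₁ {u} u≤t = subst (AdmissibleSlot B (suc n) (insert n ρ (n ∸ suc t)))
    (sym (+-∸-assoc 1 (≤-trans u≤t t≤n)))
    (slot-insertAbove (¬b z<s) (∸-monoʳ-≤ n u≤t) (slots (≤-trans u≤t t≤m)))

secondInsert-valid : ∀ {B n ρ s u} → B (suc n) → ValidNode B n (ρ , s) → u ≤ s →
  ValidNode B (suc n) (insert n ρ (n ∸ u) , nextState u s)
secondInsert-valid {B} {n} {ρ} {s} {zero} b v@(adm , slots , s<n) _ =
  adm₁ , slots₁ , s≤s s<n
  where
  adm₁ : Admissible B (suc n) (insert n ρ n)
  adm₁ = insertAt-admissible v z≤n
  slots₁ : BottomSlots B (suc n) (insert n ρ n) (suc s)
  slots₁ {zero}  _         = bottomSlot-admissible adm₁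
  slots₁ {suc w} (s≤s w≤s) = slot-insertBottom b (Admissible.bounded adm) (slots w≤s)
secondInsert-valid {B} {n} {ρ} {u = suc u} _ v u≤s =
  adm₁ , slots₁ , z<s
  where
  adm₁ : Admissible B (suc n) (insert n ρ (n ∸ suc u))
  adm₁ = insertAt-admissible v u≤s
  slots₁ : BottomSlots B (suc n) (insert n ρ (n ∸ suc u)) 0
  slots₁ z≤n = bottomSlot-admissible adm₁

children-valid : ∀ {B n} x → B (suc (suc n)) → (0 < proj₂ x → ¬ B (suc n)) →
  ValidNode B n x → All (ValidNode B (suc (suc n))) (children n x)
children-valid (ρ , m) b ¬b v = All.concat⁺ (All.applyUpTo⁺₁ _ (suc m) λ t<1+m →
  All.applyUpTo⁺₁ _ _ λ u<1+w →
    secondInsert-valid b (firstInsert-valid v (s≤s⁻¹ t<1+m) (λ 0<t → ¬b (<-≤-trans 0<t (s≤s⁻¹ t<1+m))))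
      (s≤s⁻¹ u<1+w))

root-admissible : ∀ {B} → Admissible B 1 (λ _ → 0)
root-admissible = record
  { injective = λ { (s≤s z≤n) (s≤s z≤n) _ → refl }
  ; bounded   = λ _ → z<s
  ; triples   = λ { _ () (s≤s z≤n) }
  }

firstLabel∉ : ∀ {B : ℕ → Set} → (∀ k → ¬ B (4 + k * 2)) →
  ∀ k {m} → m < suc (k * 2) → 0 < m → ¬ B (2 + k * 2)
firstLabel∉ even∉ zero    m<1 0<m = contradiction (<-≤-trans 0<m (s≤s⁻¹ m<1)) λ ()
firstLabel∉ even∉ (suc k) _   _   = even∉ k

family-valid : ∀ {B : ℕ → Set} → (∀ k → B (3 + k * 2)) → (∀ k → ¬ B (4 + k * 2)) →
  ∀ k → All (ValidNode B (suc (k * 2))) (family k)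
family-valid odd∈ even∉ zero =
  (root-admissible , (λ { z≤n → bottomSlot-admissible root-admissible }) , z<s) ∷ []
family-valid {B} odd∈ even∉ (suc k) = All.concat⁺ (All.map⁺ (All.map
  (λ {x} v → children-valid x (odd∈ k) (firstLabel∉ {B} even∉ k (proj₂ (proj₂ v))) v)
  (family-valid odd∈ even∉ k)))

Differ : ℕ → Ranking → Ranking → Set
Differ n ρ ρ′ = ∃ λ x → x < n × ρ x ≢ ρ′ x

insert-differ-new : ∀ {n} ρ ρ′ {p p′} → p ≢ p′ → Differ (suc n) (insert n ρ p) (insert n ρ′ p′)
insert-differ-new {n} ρ ρ′ {p} {p′} p≢p′ =
  n , n<1+n n , λ eq → p≢p′ (trans (sym (insert-new n ρ p)) (trans eq (insert-new n ρ′ p′)))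

insert-differ-old : ∀ {n ρ ρ′} p p′ → Differ n ρ ρ′ →
  Differ (suc n) (insert n ρ p) (insert n ρ′ p′)
insert-differ-old {ρ = ρ} {ρ′} p p′ (x , x<n , ρx≢ρ′x) with p ≟ p′
... | no  p≢p′ = insert-differ-new ρ ρ′ p≢p′
... | yes refl = x , m<n⇒m<1+n x<n , λ eq →
  ρx≢ρ′x (shift-injective p (trans (sym (insert-old ρ p x<n)) (trans eq (insert-old ρ′ p x<n))))

∸-injective-≤ : ∀ {n a b} → a < b → b ≤ n → n ∸ a ≢ n ∸ b
∸-injective-≤ a<b b≤n eq = <⇒≢ (∸-monoʳ-< a<b b≤n) (sym eq)

width≤ : ∀ {n t} → t < n → width t ≤ n
width≤ {t = zero}  0<n   = 0<n
width≤ {t = suc _} 1+t<n = <⇒≤ 1+t<n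

children-distinct : ∀ {n} x → proj₂ x < n → AllPairs (Differ (suc (suc n)) on proj₁) (children n x)
children-distinct {n} (ρ , m) m<n =
  AllPairs.concat⁺ (All.applyUpTo⁺₁ (block n ρ) (suc m) within)
                   (AllPairs.applyUpTo⁺₁ (block n ρ) (suc m) across)
  where
  within : ∀ {t} → t < suc m → AllPairs (Differ (suc (suc n)) on proj₁) (block n ρ t)
  within {t} t<1+m = AllPairs.applyUpTo⁺₁ (child n ρ t) _ λ u<u′ u′<1+w → insert-differ-new _ _
    (∸-injective-≤ u<u′ (≤-trans (s≤s⁻¹ u′<1+w) (m≤n⇒m≤1+n (width≤ (<-≤-trans t<1+m m<n)))))
  across : ∀ {t t′} → t < t′ → t′ < suc m →
    All (λ a → All ((Differ (suc (suc n)) on proj₁) a) (block n ρ t′)) (block n ρ t)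
  across {t} {t′} t<t′ t′<1+m =
    All.applyUpTo⁺₂ (child n ρ t) _ λ _ → All.applyUpTo⁺₂ (child n ρ t′) _ λ _ →
      insert-differ-old _ _ (insert-differ-new ρ ρ (∸-injective-≤ t<t′ (<⇒≤ (<-≤-trans t′<1+m m<n))))

parents-distinct : ∀ {n ρ ρ′} m m′ → Differ n ρ ρ′ →
  All (λ a → All ((Differ (suc (suc n)) on proj₁) a) (children n (ρ′ , m′))) (children n (ρ , m))
parents-distinct {n} {ρ} {ρ′} m m′ d =
  All.concat⁺ (All.applyUpTo⁺₂ (block n ρ) (suc m) λ t →
    All.applyUpTo⁺₂ (child n ρ t) _ λ _ →
      All.concat⁺ (All.applyUpTo⁺₂ (block n ρ′) (suc m′) λ t′ →
        All.applyUpTo⁺₂ (child n ρ′ t′) _ λ _ →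
          insert-differ-old _ _ (insert-differ-old _ _ d)))

concatMap-children-distinct : ∀ {n xs} → All (λ x → proj₂ x < n) xs → AllPairs (Differ n on proj₁) xs →
  AllPairs (Differ (suc (suc n)) on proj₁) (concatMap (children n) xs)
concatMap-children-distinct bounds distinct = AllPairs.concat⁺
  (All.map⁺ (All.map (children-distinct _) bounds))
  (AllPairs.map⁺ (AllPairs.map (λ {x} {y} → parents-distinct (proj₂ x) (proj₂ y)) distinct))

family-distinct : (∀ k → All (λ x → proj₂ x < suc (k * 2)) (family k)) →
  ∀ k → AllPairs (Differ (suc (k * 2)) on proj₁) (family k)
family-distinct bounds zero    = [] ∷ []
family-distinct bounds (suc k) = concatMap-children-distinct (bounds k) (family-distinct bounds k)

-- Rankings as members of D_[n](B)

-- The fallback value is never used for admissible rankings.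
toFin : ∀ {n} → Fin n → ℕ → Fin n
toFin {n} fallback v with v <? n
... | yes v<n = fromℕ< v<n
... | no  _   = fallback

toRankVec : (n : ℕ) → Ranking → Vec (Fin n) n
toRankVec n ρ = tabulate λ i → toFin i (ρ (toℕ i))

toℕ-lookup-toRankVec : ∀ {n} ρ (i : Fin n) → ρ (toℕ i) < n →
  toℕ (lookup (toRankVec n ρ) i) ≡ ρ (toℕ i)
toℕ-lookup-toRankVec {n} ρ i ρi<n rewrite lookup∘tabulate (λ i → toFin i (ρ (toℕ i))) i
  with ρ (toℕ i) <? n
... | yes v<n   = toℕ-fromℕ< v<n
... | no  ρi≮n = contradiction ρi<n ρi≮n

toRankVec-InD : ∀ {B n ρ} → Admissible B n ρ → InD n B (toRankVec n ρ)
toRankVec-InD {B} {n} {ρ} adm = linear , triples′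
  where
  open Admissible adm
  r : Vec (Fin n) n
  r = toRankVec n ρ
  pos : ∀ x → toℕ (lookup r x) ≡ ρ (toℕ x)
  pos x = toℕ-lookup-toRankVec ρ x (bounded (toℕ<n x))
  above : ∀ {x y} → Above r x y → ρ (toℕ x) < ρ (toℕ y)
  above = subst₂ _<_ (pos _) (pos _)
  linear : LinearOrder n r
  linear i j eq = toℕ-injective (injective (toℕ<n i) (toℕ<n j)
    (trans (sym (pos i)) (trans (cong toℕ eq) (pos j))))
  triples′ : ∀ (i j k : Fin n) → toℕ i < toℕ j → toℕ j < toℕ k →
    (B (suc (toℕ j)) → OneN3 r i j k) × (¬ B (suc (toℕ j)) → ThreeN1 r i j k)
  triples′ i j k i<j j<k with triples i<j j<k (toℕ<n k)
  ... | triple one three =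
    (λ b (ji , ki) → one b (above ji , above ki)) , (λ b (ki , kj) → three b (above ki , above kj))

differ⇒toRankVec≢ : ∀ {n ρ ρ′} → (∀ {x} → x < n → ρ x < n) → (∀ {x} → x < n → ρ′ x < n) →
  Differ n ρ ρ′ → toRankVec n ρ ≢ toRankVec n ρ′
differ⇒toRankVec≢ {n} {ρ} {ρ′} bounded bounded′ (x , x<n , ρx≢ρ′x) eq = ρx≢ρ′x (begin
  ρ x                             ≡⟨ cong ρ (sym toℕi≡x) ⟩
  ρ (toℕ i)                       ≡⟨ toℕ-lookup-toRankVec ρ i (at-i bounded) ⟨
  toℕ (lookup (toRankVec n ρ) i)  ≡⟨ cong (λ r → toℕ (lookup r i)) eq ⟩
  toℕ (lookup (toRankVec n ρ′) i) ≡⟨ toℕ-lookup-toRankVec ρ′ i (at-i bounded′) ⟩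
  ρ′ (toℕ i)                      ≡⟨ cong ρ′ toℕi≡x ⟩
  ρ′ x                            ∎)
  where
  open ≡-Reasoning
  i : Fin n
  i = fromℕ< x<n
  toℕi≡x : toℕ i ≡ x
  toℕi≡x = toℕ-fromℕ< x<n
  at-i : ∀ {σ : Ranking} → (∀ {y} → y < n → σ y < n) → σ (toℕ i) < n
  at-i {σ} bounded-σ = subst (λ y → σ y < n) (sym toℕi≡x) (bounded-σ x<n)

allPairs-zipWith : ∀ {A : Set} {P : A → Set} {R S : A → A → Set} {xs} →
  (∀ {x y} → P x → P y → R x y → S x y) → All P xs → AllPairs R xs → AllPairs S xs
allPairs-zipWith f []         []         = []
allPairs-zipWith f (px ∷ pxs) (rx ∷ rxs) =
  All.zipWith (λ (py , r) → f px py r) (pxs , rx) ∷ allPairs-zipWith f pxs rxs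

lookup-injective : ∀ {A B : Set} {f : A → B} {xs} → AllPairs (λ x y → f x ≢ f y) xs →
  ∀ a b → f (List.lookup xs a) ≡ f (List.lookup xs b) → a ≡ b
lookup-injective (_    ∷ _)   Fin.zero    Fin.zero    _  = refl
lookup-injective (x≢xs ∷ _)   Fin.zero    (Fin.suc b) eq = contradiction eq (All.lookup x≢xs (∈-lookup b))
lookup-injective (x≢xs ∷ _)   (Fin.suc a) Fin.zero    eq = contradiction (sym eq) (All.lookup x≢xs (∈-lookup a))
lookup-injective (_    ∷ xs!) (Fin.suc a) (Fin.suc b) eq = cong Fin.suc (lookup-injective xs! a b eq)

atLeast-rankings : ∀ {B n} (ρs : List Ranking) → All (Admissible B n) ρs → AllPairs (Differ n) ρs →
  AtLeast n B (length ρs)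
atLeast-rankings {B} {n} ρs adm distinct = toRankVec n ∘ List.lookup ρs , injective , member
  where
  injective : ∀ a b → toRankVec n (List.lookup ρs a) ≡ toRankVec n (List.lookup ρs b) → a ≡ b
  injective = lookup-injective (allPairs-zipWith
    (λ aρ aρ′ → differ⇒toRankVec≢ (Admissible.bounded aρ) (Admissible.bounded aρ′)) adm distinct)
  member : ∀ a → InD n B (toRankVec n (List.lookup ρs a))
  member a = toRankVec-InD (All.lookup adm (∈-lookup a))

-- B_n without its upper cutoff n - 3 + p_n.
OddAlternating : ℕ → Set
OddAlternating m = m ≡ 2 ⊎ (m % 2 ≡ 1 × 3 ≤ m)

even%2 : ∀ k → k * 2 % 2 ≡ 0
even%2 k = m*n%n≡0 k 2

odd%2 : ∀ k → suc (k * 2) % 2 ≡ 1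
odd%2 k = [m+kn]%n≡m%n 1 k 2

oddLabel∈ : ∀ k → OddAlternating (3 + k * 2)
oddLabel∈ k = inj₂ (odd%2 k , s≤s (s≤s (s≤s z≤n)))

evenLabel∉ : ∀ k → ¬ OddAlternating (4 + k * 2)
evenLabel∉ k (inj₁ ())
evenLabel∉ k (inj₂ (odd , _)) = contradiction (trans (sym (even%2 k)) odd) λ ()

Admissible-cong : ∀ {B B′ n ρ} → (∀ {m} → m < n → B m → B′ m) → (∀ {m} → m < n → B′ m → B m) →
                  Admissible B n ρ → Admissible B′ n ρ
Admissible-cong {B′ = B′} {n} {ρ} B⇒B′ B′⇒B adm = record
  { injective = injective ; bounded = bounded ; triples = triples′ }
  where
  open Admissible adm
  triples′ : ∀ {i j k} → i < j → j < k → k < n → Triple B′ ρ i j k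
  triples′ i<j j<k k<n with triples i<j j<k k<n
  ... | triple one three = triple (one ∘ B′⇒B (≤-trans (s≤s j<k) k<n))
                                  (λ ¬b′ → three (¬b′ ∘ B⇒B′ (≤-trans (s≤s j<k) k<n)))

appendBottom-admissible : ∀ {B n ρ} → Admissible B n ρ → Admissible B (suc n) (insert n ρ n)
appendBottom-admissible adm = insert-admissible adm ≤-refl (bottomSlot-admissible adm)

InB⇒OddAlternating : ∀ {n m} → InB n m → OddAlternating m
InB⇒OddAlternating (inj₁ m≡2)             = inj₁ m≡2
InB⇒OddAlternating (inj₂ (odd , 3≤m , _)) = inj₂ (odd , 3≤m)

oddLabel-bound : ∀ k {m} → m % 2 ≡ 1 → m < suc (k * 2) → m ≤ pred (k * 2)
oddLabel-bound k {m} odd m<1+2k = <⇒≤pred (≤∧≢⇒< (s≤s⁻¹ m<1+2k) m≢2k)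
  where
  m≢2k : m ≢ k * 2
  m≢2k refl = contradiction (trans (sym odd) (even%2 k)) λ ()

OddAlternating⇒InB : ∀ {k m n} → pred (k * 2) ≤ (n ∸ 3) + n % 2 → m < suc (k * 2) →
  OddAlternating m → InB n m
OddAlternating⇒InB _     _      (inj₁ m≡2)       = inj₁ m≡2
OddAlternating⇒InB {k} bound m<1+2k (inj₂ (odd , 3≤m)) =
  inj₂ (odd , 3≤m , ≤-trans (oddLabel-bound k odd m<1+2k) bound)

oddSize-bound : ∀ k → pred (k * 2) ≤ (suc (k * 2) ∸ 3) + suc (k * 2) % 2
oddSize-bound zero    = z≤n
oddSize-bound (suc k) rewrite odd%2 k = ≤-reflexive (+-comm 1 (k * 2))

evenSize-bound : ∀ k → pred (k * 2) ≤ (suc (suc (k * 2)) ∸ 3) + suc (suc (k * 2)) % 2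
evenSize-bound zero    = z≤n
evenSize-bound (suc k) rewrite even%2 k = ≤-reflexive (sym (+-identityʳ _))

admissible-InB : ∀ {k n ρ} → pred (k * 2) ≤ (n ∸ 3) + n % 2 →
  Admissible OddAlternating (suc (k * 2)) ρ → Admissible (InB n) (suc (k * 2)) ρ
admissible-InB {k} {n} bound =
  Admissible-cong (OddAlternating⇒InB {k} {n = n} bound) (λ _ → InB⇒OddAlternating {n})

family-oddAlternating : ∀ k → All (ValidNode OddAlternating (suc (k * 2))) (family k)
family-oddAlternating = family-valid oddLabel∈ evenLabel∉

family-admissible : ∀ k → All (λ x → Admissible OddAlternating (suc (k * 2)) (proj₁ x)) (family k)
family-admissible k = All.map proj₁ (family-oddAlternating k)

family-states< : ∀ k → All (λ x → proj₂ x < suc (k * 2)) (family k)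
family-states< k = All.map (proj₂ ∘ proj₂) (family-oddAlternating k)

oddSize-atLeast : ∀ k → AtLeast (suc (k * 2)) (InB (suc (k * 2))) (length (family k))
oddSize-atLeast k = subst (AtLeast n (InB n)) (length-map proj₁ (family k))
  (atLeast-rankings _
    (All.map⁺ (All.map (admissible-InB {k} {n} (oddSize-bound k)) (family-admissible k)))
    (AllPairs.map⁺ (family-distinct family-states< k)))
  where
  n : ℕ
  n = suc (k * 2)

-- Appending at the bottom is admissible for every scheme, so B_{2k+2} only has to agree with
-- OddAlternating on the middles of triples among the first 2k + 1 alternatives.
evenSize-atLeast : ∀ k → AtLeast (suc (suc (k * 2))) (InB (suc (suc (k * 2)))) (length (family k))
evenSize-atLeast k = subst (AtLeast (suc n) (InB (suc n))) (length-map appendBottom (family k))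
  (atLeast-rankings _
    (All.map⁺ (All.map (appendBottom-admissible ∘ admissible-InB {k} {suc n} (evenSize-bound k))
                       (family-admissible k)))
    (AllPairs.map⁺ (AllPairs.map (insert-differ-old n n) (family-distinct family-states< k))))
  where
  n : ℕ
  n = suc (k * 2)
  appendBottom : Node → Ranking
  appendBottom (ρ , _) = insert n ρ n

-- Counting states

weight : (ℕ → ℕ) → List ℕ → ℕ
weight h = sum ∘ map h

weight-++ : ∀ h xs ys → weight h (xs ++ ys) ≡ weight h xs + weight h ys
weight-++ h xs ys = trans (cong sum (map-++ h xs ys)) (sum-++ (map h xs) (map h ys))

weight-concatMap : ∀ h (F : ℕ → List ℕ) xs → weight h (concatMap F xs) ≡ weight (weight h ∘ F) xs
weight-concatMap h F []       = refl
weight-concatMap h F (x ∷ xs) =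
  trans (weight-++ h (F x) (concatMap F xs)) (cong (weight h (F x) +_) (weight-concatMap h F xs))

weight-cong : ∀ {h g} xs → (∀ x → h x ≡ g x) → weight h xs ≡ weight g xs
weight-cong []       _  = refl
weight-cong (x ∷ xs) eq = cong₂ _+_ (eq x) (weight-cong xs eq)

weight-mono : ∀ {h g} xs → (∀ x → h x ≤ g x) → weight h xs ≤ weight g xs
weight-mono []       _  = z≤n
weight-mono (x ∷ xs) le = +-mono-≤ (le x) (weight-mono xs le)

weight-+ : ∀ h g xs → weight (λ x → h x + g x) xs ≡ weight h xs + weight g xs
weight-+ h g []       = refl
weight-+ h g (x ∷ xs) = trans (cong (h x + g x +_) (weight-+ h g xs)) (+-interchange (h x) (g x) (weight h xs) _)

weight-* : ∀ c h xs → weight (λ x → c * h x) xs ≡ c * weight h xs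
weight-* c h []       = sym (*-zeroʳ c)
weight-* c h (x ∷ xs) = trans (cong (c * h x +_) (weight-* c h xs)) (sym (*-distribˡ-+ c (h x) (weight h xs)))

weight-linear : ∀ a b h h′ xs → weight (λ x → a * h x + b * h′ x) xs ≡ a * weight h xs + b * weight h′ xs
weight-linear a b h h′ xs =
  trans (weight-+ (λ x → a * h x) (λ x → b * h′ x) xs) (cong₂ _+_ (weight-* a h xs) (weight-* b h′ xs))

weight-1 : ∀ xs → weight (λ _ → 1) xs ≡ length xs
weight-1 []       = refl
weight-1 (x ∷ xs) = cong suc (weight-1 xs)

weight-vanish : ∀ {h b} xs → All (_< b) xs → (∀ {x} → x < b → h x ≡ 0) → weight h xs ≡ 0
weight-vanish []       []         _    = refl
weight-vanish {h} (x ∷ xs) (x<b ∷ xs<b) vanish =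
  trans (cong (_+ weight h xs) (vanish x<b)) (weight-vanish xs xs<b vanish)

weight-const : ∀ h c s → weight h (applyUpTo (λ _ → c) s) ≡ s * h c
weight-const h c zero    = refl
weight-const h c (suc s) = cong (h c +_) (weight-const h c s)

blockStates : ℕ → List ℕ
blockStates s = applyUpTo (λ u → nextState u s) (suc s)

childStates : ℕ → List ℕ
childStates m = concat (applyUpTo (blockStates ∘ width) (suc m))

stateList : ℕ → List ℕ
stateList zero    = [ 0 ]
stateList (suc k) = concatMap childStates (stateList k)

map-concat-applyUpTo : ∀ {A B : Set} (g : A → B) (F : ℕ → List A) (G : ℕ → List B) n →
  (∀ i → map g (F i) ≡ G i) → map g (concat (applyUpTo F n)) ≡ concat (applyUpTo G n)
map-concat-applyUpTo g F G zero    eq = refl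
map-concat-applyUpTo g F G (suc n) eq = begin
  map g (F 0 ++ concat (applyUpTo (F ∘ suc) n))         ≡⟨ map-++ g (F 0) _ ⟩
  map g (F 0) ++ map g (concat (applyUpTo (F ∘ suc) n))
    ≡⟨ cong₂ _++_ (eq 0) (map-concat-applyUpTo g (F ∘ suc) (G ∘ suc) n (eq ∘ suc)) ⟩
  G 0 ++ concat (applyUpTo (G ∘ suc) n)                 ∎
  where open ≡-Reasoning

children-states : ∀ n x → map proj₂ (children n x) ≡ childStates (proj₂ x)
children-states n (ρ , m) = map-concat-applyUpTo proj₂ (block n ρ) (blockStates ∘ width) (suc m)
  λ t → map-applyUpTo (child n ρ t) proj₂ (suc (width t))

family-states : ∀ k → map proj₂ (family k) ≡ stateList k
family-states zero    = refl
family-states (suc k) = begin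
  map proj₂ (concatMap (children n) (family k))  ≡⟨ map-concatMap proj₂ (children n) (family k) ⟩
  concatMap (map proj₂ ∘ children n) (family k)  ≡⟨ concatMap-cong (children-states n) (family k) ⟩
  concatMap (childStates ∘ proj₂) (family k)     ≡⟨ concatMap-map childStates proj₂ (family k) ⟨
  concatMap childStates (map proj₂ (family k))   ≡⟨ cong (concatMap childStates) (family-states k) ⟩
  stateList (suc k)                              ∎
  where
  open ≡-Reasoning
  n : ℕ
  n = suc (k * 2)

transfer : (ℕ → ℕ) → ℕ → ℕ
transfer h m = weight h (childStates m)

weight-stateList-suc : ∀ h k → weight h (stateList (suc k)) ≡ weight (transfer h) (stateList k)
weight-stateList-suc h k = weight-concatMap h childStates (stateList k)

transfer-zero : ∀ h → transfer h 0 ≡ h 2 + h 0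
transfer-zero h = cong (h 2 +_) (+-identityʳ (h 0))

transfer-suc : ∀ h m → transfer h (suc m) ≡ transfer h m + (h (2 + m) + suc m * h 0)
transfer-suc h m = begin
  weight h (concat (applyUpTo F (2 + m)))
    ≡⟨ cong (weight h ∘ concat) (applyUpTo-∷ʳ F (suc m)) ⟨
  weight h (concat (applyUpTo F (suc m) ++ [ F (suc m) ]))
    ≡⟨ cong (weight h) (concat-++ (applyUpTo F (suc m)) _) ⟨
  weight h (childStates m ++ F (suc m) ++ [])
    ≡⟨ weight-++ h (childStates m) _ ⟩
  transfer h m + weight h (F (suc m) ++ [])
    ≡⟨ cong (λ xs → transfer h m + weight h xs) (++-identityʳ (F (suc m))) ⟩
  transfer h m + (h (2 + m) + weight h (applyUpTo (λ _ → 0) (suc m)))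
    ≡⟨ cong (λ w → transfer h m + (h (2 + m) + w)) (weight-const h 0 (suc m)) ⟩
  transfer h m + (h (2 + m) + suc m * h 0) ∎
  where
  open ≡-Reasoning
  F : ℕ → List ℕ
  F = blockStates ∘ width

-- The eigenfunction of the transfer operator

P : ℕ → ℕ
P zero          = 2
P (suc zero)    = 4
P (suc (suc m)) = 2 * P m

Q : ℕ → ℕ
Q zero          = 2
Q (suc zero)    = 2
Q (suc (suc m)) = 2 * Q m

-- f + √2 g is the eigenfunction of transfer for 2 + 2√2 normalised by f 0 = 1, g 0 = 0.
f : ℕ → ℕ
f m = P m ∸ suc m

g : ℕ → ℕ
g m = Q m ∸ 2

2+m≤P : ∀ m → 2 + m ≤ P m
2+m≤P zero          = ≤-refl
2+m≤P (suc zero)    = s≤s (s≤s (s≤s z≤n))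
2+m≤P (suc (suc m)) = ≤-trans (≤-trans (m≤m+n (4 + m) m) (≤-reflexive (eq m))) (*-monoʳ-≤ 2 (2+m≤P m))
  where
  eq : ∀ m → 4 + m + m ≡ 2 * (2 + m)
  eq = solve-∀

2≤Q : ∀ m → 2 ≤ Q m
2≤Q zero          = ≤-refl
2≤Q (suc zero)    = ≤-refl
2≤Q (suc (suc m)) = ≤-trans (2≤Q m) (m≤n*m (Q m) 2)

f+1+m≡P : ∀ m → f m + suc m ≡ P m
f+1+m≡P m = m∸n+n≡m (<⇒≤ (2+m≤P m))

g+2≡Q : ∀ m → g m + 2 ≡ Q m
g+2≡Q m = m∸n+n≡m (2≤Q m)

P-identity : ∀ m → 2 * P m + 4 * Q m + P (2 + m) ≡ 2 * P (suc m) + 4 * Q (suc m)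
P-identity zero          = refl
P-identity (suc zero)    = refl
P-identity (suc (suc m)) = begin
  2 * (2 * P m) + 4 * (2 * Q m) + 2 * P (2 + m) ≡⟨ doubled (P m) (Q m) (P (2 + m)) ⟩
  2 * (2 * P m + 4 * Q m + P (2 + m))           ≡⟨ cong (2 *_) (P-identity m) ⟩
  2 * (2 * P (suc m) + 4 * Q (suc m))           ≡⟨ doubled′ (P (suc m)) (Q (suc m)) ⟨
  2 * (2 * P (suc m)) + 4 * (2 * Q (suc m))     ∎
  where
  open ≡-Reasoning
  doubled : ∀ a b c → 2 * (2 * a) + 4 * (2 * b) + 2 * c ≡ 2 * (2 * a + 4 * b + c)
  doubled = solve-∀
  doubled′ : ∀ a b → 2 * (2 * a) + 4 * (2 * b) ≡ 2 * (2 * a + 4 * b)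
  doubled′ = solve-∀

Q-identity : ∀ m → 2 * P m + 2 * Q m + Q (2 + m) ≡ 2 * P (suc m) + 2 * Q (suc m)
Q-identity zero          = refl
Q-identity (suc zero)    = refl
Q-identity (suc (suc m)) = begin
  2 * (2 * P m) + 2 * (2 * Q m) + 2 * Q (2 + m) ≡⟨ doubled (P m) (Q m) (Q (2 + m)) ⟩
  2 * (2 * P m + 2 * Q m + Q (2 + m))           ≡⟨ cong (2 *_) (Q-identity m) ⟩
  2 * (2 * P (suc m) + 2 * Q (suc m))           ≡⟨ doubled′ (P (suc m)) (Q (suc m)) ⟨
  2 * (2 * P (suc m)) + 2 * (2 * Q (suc m))     ∎
  where
  open ≡-Reasoning
  doubled : ∀ a b c → 2 * (2 * a) + 2 * (2 * b) + 2 * c ≡ 2 * (2 * a + 2 * b + c)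
  doubled = solve-∀
  doubled′ : ∀ a b → 2 * (2 * a) + 2 * (2 * b) ≡ 2 * (2 * a + 2 * b)
  doubled′ = solve-∀

-- Adding back what f and g subtract from P and Q reduces f-step to P-identity and g-step to Q-identity.
f-step : ∀ m → 2 * f m + 4 * g m + (f (2 + m) + suc m * 1) ≡ 2 * f (suc m) + 4 * g (suc m)
f-step m = +-cancelʳ-≡ (3 * m + 13) _ _ (begin
  2 * f m + 4 * g m + (f (2 + m) + suc m * 1) + (3 * m + 13)
    ≡⟨ shiftˡ (f m) (g m) (f (2 + m)) m ⟩
  2 * (f m + suc m) + 4 * (g m + 2) + (f (2 + m) + suc (2 + m)) + suc m
    ≡⟨ cong₂ (λ a c → 2 * a + 4 * (g m + 2) + c + suc m) (f+1+m≡P m) (f+1+m≡P (2 + m)) ⟩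
  2 * P m + 4 * (g m + 2) + P (2 + m) + suc m
    ≡⟨ cong (λ b → 2 * P m + 4 * b + P (2 + m) + suc m) (g+2≡Q m) ⟩
  2 * P m + 4 * Q m + P (2 + m) + suc m
    ≡⟨ cong (_+ suc m) (P-identity m) ⟩
  2 * P (suc m) + 4 * Q (suc m) + suc m
    ≡⟨ cong₂ (λ a b → 2 * a + 4 * b + suc m) (f+1+m≡P (suc m)) (g+2≡Q (suc m)) ⟨
  2 * (f (suc m) + suc (suc m)) + 4 * (g (suc m) + 2) + suc m
    ≡⟨ shiftʳ (f (suc m)) (g (suc m)) m ⟩
  2 * f (suc m) + 4 * g (suc m) + (3 * m + 13) ∎)
  where
  open ≡-Reasoning
  shiftˡ : ∀ a b c m → 2 * a + 4 * b + (c + (1 + m) * 1) + (3 * m + 13)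
                     ≡ 2 * (a + (1 + m)) + 4 * (b + 2) + (c + (3 + m)) + (1 + m)
  shiftˡ = solve-∀
  shiftʳ : ∀ a b m → 2 * (a + (2 + m)) + 4 * (b + 2) + (1 + m) ≡ 2 * a + 4 * b + (3 * m + 13)
  shiftʳ = solve-∀

g-step : ∀ m → 2 * f m + 2 * g m + (g (2 + m) + suc m * 0) ≡ 2 * f (suc m) + 2 * g (suc m)
g-step m = +-cancelʳ-≡ (2 * m + 8) _ _ (begin
  2 * f m + 2 * g m + (g (2 + m) + suc m * 0) + (2 * m + 8)
    ≡⟨ shiftˡ (f m) (g m) (g (2 + m)) m ⟩
  2 * (f m + suc m) + 2 * (g m + 2) + (g (2 + m) + 2)
    ≡⟨ cong₂ (λ a b → 2 * a + 2 * b + (g (2 + m) + 2)) (f+1+m≡P m) (g+2≡Q m) ⟩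
  2 * P m + 2 * Q m + (g (2 + m) + 2)
    ≡⟨ cong (2 * P m + 2 * Q m +_) (g+2≡Q (2 + m)) ⟩
  2 * P m + 2 * Q m + Q (2 + m)
    ≡⟨ Q-identity m ⟩
  2 * P (suc m) + 2 * Q (suc m)
    ≡⟨ cong₂ (λ a b → 2 * a + 2 * b) (f+1+m≡P (suc m)) (g+2≡Q (suc m)) ⟨
  2 * (f (suc m) + suc (suc m)) + 2 * (g (suc m) + 2)
    ≡⟨ shiftʳ (f (suc m)) (g (suc m)) m ⟩
  2 * f (suc m) + 2 * g (suc m) + (2 * m + 8) ∎)
  where
  open ≡-Reasoning
  shiftˡ : ∀ a b c m → 2 * a + 2 * b + (c + (1 + m) * 0) + (2 * m + 8)
                     ≡ 2 * (a + (1 + m)) + 2 * (b + 2) + (c + 2)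
  shiftˡ = solve-∀
  shiftʳ : ∀ a b m → 2 * (a + (2 + m)) + 2 * (b + 2) ≡ 2 * a + 2 * b + (2 * m + 8)
  shiftʳ = solve-∀

transfer-f : ∀ m → transfer f m ≡ 2 * f m + 4 * g m
transfer-f zero    = transfer-zero f
transfer-f (suc m) =
  trans (transfer-suc f m) (trans (cong (_+ (f (2 + m) + suc m * f 0)) (transfer-f m)) (f-step m))

transfer-g : ∀ m → transfer g m ≡ 2 * f m + 2 * g m
transfer-g zero    = transfer-zero g
transfer-g (suc m) =
  trans (transfer-suc g m) (trans (cong (_+ (g (2 + m) + suc m * g 0)) (transfer-g m)) (g-step m))

-- (a , b) stands for a + b√2 and times multiplies it by 2 + 2√2.
times : ℕ × ℕ → ℕ × ℕ
times (a , b) = (2 * a + 4 * b , 2 * a + 2 * b)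

pow-suc : ∀ k → pow (suc k) ≡ times (pow k)
pow-suc k = refl

stateList-weights : ∀ k → (weight f (stateList k) , weight g (stateList k)) ≡ pow k
stateList-weights zero    = refl
stateList-weights (suc k) = begin
  (weight f (stateList (suc k)) , weight g (stateList (suc k)))
    ≡⟨ cong₂ _,_ (step 4 f transfer-f) (step 2 g transfer-g) ⟩
  times (weight f L , weight g L)
    ≡⟨ cong times (stateList-weights k) ⟩
  times (pow k)
    ≡⟨ pow-suc k ⟨
  pow (suc k) ∎
  where
  open ≡-Reasoning
  L : List ℕ
  L = stateList k
  step : ∀ c h → (∀ m → transfer h m ≡ 2 * f m + c * g m) →
    weight h (stateList (suc k)) ≡ 2 * weight f L + c * weight g L
  step c h eigen = trans (weight-stateList-suc h k) (trans (weight-cong L eigen) (weight-linear 2 c f g L))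

-- Halving sequences and their tails

downward-induction : ∀ {C : ℕ → Set} b → (∀ {y} → b < y → C y) → (∀ {y} → C (suc y) → C y) →
                     ∀ y → C y
downward-induction {C} b above step y = go b y (m≤n+m b y)
  where
  go : ∀ d y → b ≤ y + d → C y
  go zero    y b≤y   = step (above (s≤s (subst (b ≤_) (+-identityʳ y) b≤y)))
  go (suc d) y b≤y+d = step (go d (suc y) (subst (b ≤_) (+-suc y d) b≤y+d))

Halving : (ℕ → ℕ) → ℕ → Set
Halving N y₀ = ∀ {y} → y₀ ≤ y → 2 * N (suc y) ≤ N y

tail-halving : ∀ {N T : ℕ → ℕ} {y₀} b → (∀ y → T y ≡ N y + T (suc y)) →
  (∀ {y} → b < y → T y ≡ 0) → Halving N y₀ → Halving T y₀
tail-halving {N} {T} {y₀} b split vanish halving {y} = downward-induction b base step y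
  where
  base : ∀ {y} → b < y → y₀ ≤ y → 2 * T (suc y) ≤ T y
  base {y} b<y _ rewrite vanish (m<n⇒m<1+n b<y) = z≤n
  step : ∀ {y} → (y₀ ≤ suc y → 2 * T (suc (suc y)) ≤ T (suc y)) → y₀ ≤ y → 2 * T (suc y) ≤ T y
  step {y} next y₀≤y = begin
    2 * T (suc y)                           ≡⟨ cong (2 *_) (split (suc y)) ⟩
    2 * (N (suc y) + T (suc (suc y)))       ≡⟨ *-distribˡ-+ 2 (N (suc y)) _ ⟩
    2 * N (suc y) + 2 * T (suc (suc y))     ≤⟨ +-mono-≤ (halving y₀≤y) (next (m≤n⇒m≤1+n y₀≤y)) ⟩
    N y + T (suc y)                         ≡⟨ split y ⟨
    T y                                     ∎
    where open ≤-Reasoning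

weighted-tail-bound : ∀ {N F w c : ℕ → ℕ} {y₀} b → (∀ y → F y ≡ w y * N y + F (suc y)) →
  (∀ {y} → b < y → F y ≡ 0) → (∀ {y} → y₀ ≤ y → 2 * w y + c (suc y) ≤ 2 * c y) →
  Halving N y₀ → ∀ {y} → y₀ ≤ y → F y ≤ c y * N y
weighted-tail-bound {N} {F} {w} {c} {y₀} b split vanish potential halving {y} = downward-induction b base step y
  where
  base : ∀ {y} → b < y → y₀ ≤ y → F y ≤ c y * N y
  base b<y _ rewrite vanish b<y = z≤n
  step : ∀ {y} → (y₀ ≤ suc y → F (suc y) ≤ c (suc y) * N (suc y)) → y₀ ≤ y → F y ≤ c y * N y
  step {y} next y₀≤y = *-cancelˡ-≤ 2 (begin
    2 * F y                                          ≡⟨ cong (2 *_) (split y) ⟩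
    2 * (w y * N y + F (suc y))
      ≤⟨ *-monoʳ-≤ 2 (+-monoʳ-≤ (w y * N y) (next (m≤n⇒m≤1+n y₀≤y))) ⟩
    2 * (w y * N y + c (suc y) * N (suc y))          ≡⟨ rearrange (w y) (N y) (c (suc y)) (N (suc y)) ⟩
    2 * w y * N y + c (suc y) * (2 * N (suc y))
      ≤⟨ +-monoʳ-≤ (2 * w y * N y) (*-monoʳ-≤ (c (suc y)) (halving y₀≤y)) ⟩
    2 * w y * N y + c (suc y) * N y                  ≡⟨ *-distribʳ-+ (N y) (2 * w y) (c (suc y)) ⟨
    (2 * w y + c (suc y)) * N y                      ≤⟨ *-monoˡ-≤ (N y) (potential y₀≤y) ⟩
    2 * c y * N y                                    ≡⟨ *-assoc 2 (c y) (N y) ⟩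
    2 * (c y * N y)                                  ∎)
    where
    open ≤-Reasoning
    rearrange : ∀ a n c m → 2 * (a * n + c * m) ≡ 2 * a * n + c * (2 * m)
    rearrange = solve-∀

-- The size of the family

pointMass : ℕ → ℕ → ℕ
pointMass zero    zero    = 1
pointMass zero    (suc _) = 0
pointMass (suc _) zero    = 0
pointMass (suc j) (suc x) = pointMass j x

tailMass : ℕ → ℕ → ℕ
tailMass zero    _       = 1
tailMass (suc _) zero    = 0
tailMass (suc j) (suc x) = tailMass j x

tailMass-split : ∀ j x → tailMass j x ≡ pointMass j x + tailMass (suc j) x
tailMass-split zero    zero    = refl
tailMass-split zero    (suc x) = refl
tailMass-split (suc j) zero    = refl
tailMass-split (suc j) (suc x) = tailMass-split j x

tailMass-below : ∀ {j x} → x < j → tailMass j x ≡ 0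
tailMass-below {suc j} {zero}  _         = refl
tailMass-below {suc j} {suc x} (s≤s x<j) = tailMass-below x<j

tailMass≤1 : ∀ j x → tailMass j x ≤ 1
tailMass≤1 zero    _       = ≤-refl
tailMass≤1 (suc j) zero    = z≤n
tailMass≤1 (suc j) (suc x) = tailMass≤1 j x

pointMass-scale : ∀ h j x → h x * pointMass j x ≡ h j * pointMass j x
pointMass-scale h zero    zero    = refl
pointMass-scale h zero    (suc x) = trans (*-zeroʳ (h (suc x))) (sym (*-zeroʳ (h 0)))
pointMass-scale h (suc j) zero    = trans (*-zeroʳ (h 0)) (sym (*-zeroʳ (h (suc j))))
pointMass-scale h (suc j) (suc x) = pointMass-scale (h ∘ suc) j x

transfer-pointMass : ∀ j m → transfer (pointMass (3 + j)) m ≡ tailMass (2 + j) m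
transfer-pointMass j zero    = transfer-zero (pointMass (3 + j))
transfer-pointMass j (suc m) = begin
  transfer (pointMass (3 + j)) (suc m)                  ≡⟨ transfer-suc (pointMass (3 + j)) m ⟩
  transfer (pointMass (3 + j)) m + (pointMass (1 + j) m + suc m * 0)
    ≡⟨ cong₂ (λ t z → t + (pointMass (1 + j) m + z)) (transfer-pointMass j m) (*-zeroʳ (suc m)) ⟩
  tailMass (2 + j) m + (pointMass (1 + j) m + 0)        ≡⟨ cong (tailMass (2 + j) m +_) (+-identityʳ _) ⟩
  tailMass (2 + j) m + pointMass (1 + j) m              ≡⟨ +-comm (tailMass (2 + j) m) _ ⟩
  pointMass (1 + j) m + tailMass (2 + j) m              ≡⟨ tailMass-split (1 + j) m ⟨
  tailMass (1 + j) m                                    ∎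
  where open ≡-Reasoning

transfer-pointMass-2 : ∀ m → transfer (pointMass 2) (suc m) ≡ 2
transfer-pointMass-2 zero    = refl
transfer-pointMass-2 (suc m) = begin
  transfer (pointMass 2) (2 + m)                                          ≡⟨ transfer-suc (pointMass 2) (suc m) ⟩
  transfer (pointMass 2) (suc m) + (pointMass 2 (3 + m) + suc (suc m) * 0)
    ≡⟨ cong₂ (λ t z → t + (0 + z)) (transfer-pointMass-2 m) (*-zeroʳ (suc (suc m))) ⟩
  2 ∎
  where open ≡-Reasoning

count : ℕ → ℕ → ℕ
count k j = weight (pointMass j) (stateList k)

countFrom : ℕ → ℕ → ℕ
countFrom k j = weight (tailMass j) (stateList k)

stateList-bounded : ∀ k → All (_< suc (k * 2)) (stateList k)
stateList-bounded k = subst (All (_< suc (k * 2))) (family-states k) (All.map⁺ (family-states< k))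

countFrom-split : ∀ k j → countFrom k j ≡ count k j + countFrom k (suc j)
countFrom-split k j =
  trans (weight-cong (stateList k) (tailMass-split j)) (weight-+ (pointMass j) (tailMass (suc j)) (stateList k))

countFrom-vanish : ∀ k {j} → k * 2 < j → countFrom k j ≡ 0
countFrom-vanish k 2k<j = weight-vanish (stateList k) (stateList-bounded k)
  λ x<1+2k → tailMass-below (≤-<-trans (s≤s⁻¹ x<1+2k) 2k<j)

count-suc : ∀ k j → count (suc k) (3 + j) ≡ countFrom k (2 + j)
count-suc k j = trans (weight-stateList-suc (pointMass (3 + j)) k) (weight-cong (stateList k) (transfer-pointMass j))

countFrom-2≤count : ∀ k → 2 * countFrom k 2 ≤ count (suc k) 2
countFrom-2≤count k = begin
  2 * countFrom k 2                      ≡⟨ weight-* 2 (tailMass 2) (stateList k) ⟨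
  weight (λ x → 2 * tailMass 2 x) (stateList k) ≤⟨ weight-mono (stateList k) le ⟩
  weight (transfer (pointMass 2)) (stateList k) ≡⟨ weight-stateList-suc (pointMass 2) k ⟨
  count (suc k) 2                        ∎
  where
  open ≤-Reasoning
  le : ∀ m → 2 * tailMass 2 m ≤ transfer (pointMass 2) m
  le zero    = z≤n
  le (suc m) rewrite transfer-pointMass-2 m = *-monoʳ-≤ 2 (tailMass≤1 1 m)

count-halving : ∀ k → Halving (count k) 2
count-halving k       {suc zero}          (s≤s ())
count-halving zero    {suc (suc j)}       _ = z≤n
count-halving (suc k) {2}                 _ =
  subst (λ c → 2 * c ≤ count (suc k) 2) (sym (count-suc k 0)) (countFrom-2≤count k)
count-halving (suc k) {suc (suc (suc j))} _ = begin
  2 * count (suc k) (4 + j)  ≡⟨ cong (2 *_) (count-suc k (suc j)) ⟩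
  2 * countFrom k (3 + j)
    ≤⟨ tail-halving (k * 2) (countFrom-split k) (countFrom-vanish k) (count-halving k) (s≤s (s≤s z≤n)) ⟩
  countFrom k (2 + j)        ≡⟨ count-suc k j ⟨
  count (suc k) (3 + j)      ∎
  where open ≤-Reasoning

tailWeight : ℕ → (ℕ → ℕ) → ℕ → ℕ
tailWeight k h y = weight (λ x → h x * tailMass y x) (stateList k)

tailWeight-split : ∀ k h y → tailWeight k h y ≡ h y * count k y + tailWeight k h (suc y)
tailWeight-split k h y = begin
  tailWeight k h y
    ≡⟨ weight-cong (stateList k) split ⟩
  weight (λ x → h y * pointMass y x + h x * tailMass (suc y) x) (stateList k)
    ≡⟨ weight-+ (λ x → h y * pointMass y x) (λ x → h x * tailMass (suc y) x) (stateList k) ⟩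
  weight (λ x → h y * pointMass y x) (stateList k) + tailWeight k h (suc y)
    ≡⟨ cong (_+ tailWeight k h (suc y)) (weight-* (h y) (pointMass y) (stateList k)) ⟩
  h y * count k y + tailWeight k h (suc y) ∎
  where
  open ≡-Reasoning
  split : ∀ x → h x * tailMass y x ≡ h y * pointMass y x + h x * tailMass (suc y) x
  split x = trans (cong (h x *_) (tailMass-split y x))
    (trans (*-distribˡ-+ (h x) (pointMass y x) _) (cong (_+ h x * tailMass (suc y) x) (pointMass-scale h y x)))

tailWeight-vanish : ∀ k h {y} → k * 2 < y → tailWeight k h y ≡ 0
tailWeight-vanish k h 2k<y = weight-vanish (stateList k) (stateList-bounded k)
  λ {x} x<1+2k → trans (cong (h x *_) (tailMass-below (≤-<-trans (s≤s⁻¹ x<1+2k) 2k<y))) (*-zeroʳ (h x))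

P-mono : ∀ y → P y ≤ P (suc y)
P-mono zero          = s≤s (s≤s z≤n)
P-mono (suc zero)    = ≤-refl
P-mono (suc (suc y)) = *-monoʳ-≤ 2 (P-mono y)

potential : ℕ → ℕ
potential y = 2 * (P y + P (suc y))

potential-step : ∀ y → 2 * f y + potential (suc y) ≤ 2 * potential y
potential-step y = begin
  2 * f y + 2 * (P (suc y) + 2 * P y)        ≤⟨ +-monoˡ-≤ _ (*-monoʳ-≤ 2 (m∸n≤m (P y) (suc y))) ⟩
  2 * P y + 2 * (P (suc y) + 2 * P y)        ≡⟨ regroupˡ (P y) (P (suc y)) ⟩
  (4 * P y + 2 * P (suc y)) + 2 * P y        ≤⟨ +-monoʳ-≤ (4 * P y + 2 * P (suc y)) 2Py≤ ⟩
  (4 * P y + 2 * P (suc y)) + 2 * P (suc y)  ≡⟨ regroupʳ (P y) (P (suc y)) ⟩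
  2 * (2 * (P y + P (suc y)))                ∎
  where
  open ≤-Reasoning
  2Py≤ : 2 * P y ≤ 2 * P (suc y)
  2Py≤ = *-monoʳ-≤ 2 (P-mono y)
  regroupˡ : ∀ a b → 2 * a + 2 * (b + 2 * a) ≡ (4 * a + 2 * b) + 2 * a
  regroupˡ = solve-∀
  regroupʳ : ∀ a b → (4 * a + 2 * b) + 2 * b ≡ 2 * (2 * (a + b))
  regroupʳ = solve-∀

lowMass : ℕ → ℕ
lowMass x = pointMass 0 x + pointMass 1 x

f≤split : ∀ x → f x ≤ 24 * lowMass x + f x * tailMass 2 x
f≤split zero          = s≤s z≤n
f≤split (suc zero)    = s≤s (s≤s z≤n)
f≤split (suc (suc x)) = ≤-reflexive (sym (*-identityʳ _))

mass≤1 : ∀ x → lowMass x + pointMass 2 x ≤ 1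
mass≤1 zero                = ≤-refl
mass≤1 (suc zero)          = ≤-refl
mass≤1 (suc (suc zero))    = ≤-refl
mass≤1 (suc (suc (suc x))) = z≤n

weight-f≤ : ∀ k → weight f (stateList k) ≤ 24 * length (stateList k)
weight-f≤ k = begin
  weight f L                                        ≤⟨ weight-mono L f≤split ⟩
  weight (λ x → 24 * lowMass x + f x * tailMass 2 x) L
    ≡⟨ weight-+ (λ x → 24 * lowMass x) (λ x → f x * tailMass 2 x) L ⟩
  weight (λ x → 24 * lowMass x) L + tailWeight k f 2
    ≤⟨ +-mono-≤ (≤-reflexive (weight-* 24 lowMass L))
         (weighted-tail-bound {w = f} {c = potential} (k * 2) (tailWeight-split k f) (tailWeight-vanish k f)
            (λ {y} _ → potential-step y) (count-halving k) ≤-refl) ⟩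
  24 * weight lowMass L + 24 * count k 2            ≡⟨ *-distribˡ-+ 24 (weight lowMass L) (count k 2) ⟨
  24 * (weight lowMass L + count k 2)               ≡⟨ cong (24 *_) (weight-+ lowMass (pointMass 2) L) ⟨
  24 * weight (λ x → lowMass x + pointMass 2 x) L   ≤⟨ *-monoʳ-≤ 24 (weight-mono L mass≤1) ⟩
  24 * weight (λ _ → 1) L                           ≡⟨ cong (24 *_) (weight-1 L) ⟩
  24 * length L                                     ∎
  where
  open ≤-Reasoning
  L : List ℕ
  L = stateList k

pow≤family : ∀ k → proj₁ (pow k) ≤ 24 * length (family k)
pow≤family k = begin
  proj₁ (pow k)                      ≡⟨ cong proj₁ (stateList-weights k) ⟨
  weight f (stateList k)             ≤⟨ weight-f≤ k ⟩
  24 * length (stateList k)          ≡⟨ cong (λ xs → 24 * length xs) (family-states k) ⟨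
  24 * length (map proj₂ (family k)) ≡⟨ cong (24 *_) (length-map proj₂ (family k)) ⟩
  24 * length (family k)             ∎
  where open ≤-Reasoning

-- Powers of 2 + 2√2

-- a + 2b bounds a + b√2 from above.
powUpper : ℕ → ℕ
powUpper n = proj₁ (pow n) + 2 * proj₂ (pow n)

pow₂≤pow₁ : ∀ n → proj₂ (pow n) ≤ proj₁ (pow n)
pow₂≤pow₁ zero    = z≤n
pow₂≤pow₁ (suc n) = +-monoʳ-≤ (2 * proj₁ (pow n)) (*-monoˡ-≤ (proj₂ (pow n)) {2} {4} (s≤s (s≤s z≤n)))

powUpper-suc : ∀ n → powUpper (suc n) ≤ 6 * powUpper n
powUpper-suc n =
  ≤-trans (m≤m+n _ (4 * proj₂ (pow n))) (≤-reflexive (regroup (proj₁ (pow n)) (proj₂ (pow n))))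
  where
  regroup : ∀ a b → 2 * a + 4 * b + 2 * (2 * a + 2 * b) + 4 * b ≡ 6 * (a + 2 * b)
  regroup = solve-∀

square : ℕ × ℕ → ℕ × ℕ
square (a , b) = (a * a + 2 * (b * b) , 2 * (a * b))

square-times : ∀ x → square (times x) ≡ times (times (square x))
square-times (a , b) = cong₂ _,_ (first a b) (second a b)
  where
  first : ∀ a b → (2 * a + 4 * b) * (2 * a + 4 * b) + 2 * ((2 * a + 2 * b) * (2 * a + 2 * b))
                ≡ 2 * (2 * (a * a + 2 * (b * b)) + 4 * (2 * (a * b)))
                  + 4 * (2 * (a * a + 2 * (b * b)) + 2 * (2 * (a * b)))
  first = solve-∀
  second : ∀ a b → 2 * ((2 * a + 4 * b) * (2 * a + 2 * b))
                 ≡ 2 * (2 * (a * a + 2 * (b * b)) + 4 * (2 * (a * b)))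
                   + 2 * (2 * (a * a + 2 * (b * b)) + 2 * (2 * (a * b)))
  second = solve-∀

pow-double : ∀ k → pow (k * 2) ≡ square (pow k)
pow-double zero    = refl
pow-double (suc k) = begin
  times (times (pow (k * 2)))     ≡⟨ cong (times ∘ times) (pow-double k) ⟩
  times (times (square (pow k)))  ≡⟨ square-times (pow k) ⟨
  square (times (pow k))          ∎
  where open ≡-Reasoning

powUpper-double : ∀ k → powUpper (k * 2) ≤ 7 * (proj₁ (pow k) * proj₁ (pow k))
powUpper-double k = subst (_≤ 7 * (a * a)) (cong (λ (x , y) → x + 2 * y) (sym (pow-double k))) (begin
  a * a + 2 * (b * b) + 2 * (2 * (a * b))  ≤⟨ +-mono-≤ (+-monoʳ-≤ (a * a) (*-monoʳ-≤ 2 (*-mono-≤ b≤a b≤a)))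
                                                (*-monoʳ-≤ 2 (*-monoʳ-≤ 2 (*-monoʳ-≤ a b≤a))) ⟩
  a * a + 2 * (a * a) + 2 * (2 * (a * a))  ≡⟨ collect a ⟩
  7 * (a * a)                              ∎)
  where
  open ≤-Reasoning
  a b : ℕ
  a = proj₁ (pow k)
  b = proj₂ (pow k)
  b≤a : b ≤ a
  b≤a = pow₂≤pow₁ k
  collect : ∀ a → a * a + 2 * (a * a) + 2 * (2 * (a * a)) ≡ 7 * (a * a)
  collect = solve-∀

powUpper-suc-double : ∀ k → powUpper (suc (k * 2)) ≤ 42 * (proj₁ (pow k) * proj₁ (pow k))
powUpper-suc-double k = ≤-trans (powUpper-suc (k * 2))
  (≤-trans (*-monoʳ-≤ 6 (powUpper-double k)) (≤-reflexive (sym (*-assoc 6 7 (a * a)))))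
  where
  a : ℕ
  a = proj₁ (pow k)

powUpper-odd : ∀ k → powUpper (suc (k * 2)) ≤ 252 * (proj₁ (pow k) * proj₁ (pow k))
powUpper-odd k = ≤-trans (powUpper-suc-double k) (*-monoˡ-≤ (a * a) {42} {252} (≤ᵇ⇒≤ 42 252 tt))
  where
  a : ℕ
  a = proj₁ (pow k)

powUpper-even : ∀ k → powUpper (suc (suc (k * 2))) ≤ 252 * (proj₁ (pow k) * proj₁ (pow k))
powUpper-even k = ≤-trans (powUpper-suc (suc (k * 2)))
  (≤-trans (*-monoʳ-≤ 6 (powUpper-suc-double k)) (≤-reflexive (sym (*-assoc 6 42 (a * a)))))
  where
  a : ℕ
  a = proj₁ (pow k)

LeSqrt2-intro : ∀ {a b X} → a + 2 * b ≤ X → LeSqrt2 a b X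
LeSqrt2-intro {a} {b} {X} a+2b≤X = m+n≤o⇒m≤o a a+2b≤X , (begin
  2 * (b * b)              ≤⟨ m≤m+n (2 * (b * b)) (2 * (b * b)) ⟩
  2 * (b * b) + 2 * (b * b) ≡⟨ twice-square b ⟩
  (2 * b) * (2 * b)        ≤⟨ *-mono-≤ 2b≤X∸a 2b≤X∸a ⟩
  (X ∸ a) * (X ∸ a)        ∎)
  where
  open ≤-Reasoning
  2b≤X∸a : 2 * b ≤ X ∸ a
  2b≤X∸a = m+n≤o⇒m≤o∸n (2 * b) (subst (_≤ X) (+-comm a (2 * b)) a+2b≤X)
  twice-square : ∀ b → 2 * (b * b) + 2 * (b * b) ≡ (2 * b) * (2 * b)
  twice-square = solve-∀

boundHolds-intro : ∀ q n K → powUpper n ≤ q * q * (K * K) → BoundHolds 1 q n K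
boundHolds-intro q n K h with pow n
... | a , b = subst₂ (λ x y → LeSqrt2 x y (q * q * (K * K))) (sym (*-identityˡ a)) (sym (*-identityˡ b))
                (LeSqrt2-intro {a} {b} h)

-- 252 · 24² ≤ 384²
bound-from-count : ∀ n K {a} → powUpper n ≤ 252 * (a * a) → a ≤ 24 * K → BoundHolds 1 384 n K
bound-from-count n K {a} upper a≤24K = boundHolds-intro 384 n K (begin
  powUpper n                        ≤⟨ upper ⟩
  252 * (a * a)                     ≤⟨ *-mono-≤ (≤ᵇ⇒≤ 252 256 tt) (*-mono-≤ a≤24K a≤24K) ⟩
  256 * ((24 * K) * (24 * K))       ≡⟨ cong (256 *_) (*-interchange 24 K 24 K) ⟩
  256 * (576 * (K * K))             ≡⟨ *-assoc 256 576 (K * K) ⟨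
  256 * 576 * (K * K)               ≡⟨ cong (_* (K * K)) {256 * 576} {384 * 384} refl ⟩
  384 * 384 * (K * K)               ∎)
  where open ≤-Reasoning

parity : ∀ n → Σ ℕ λ k → n ≡ k * 2 ⊎ n ≡ suc (k * 2)
parity zero = 0 , inj₁ refl
parity (suc n) with parity n
... | k , inj₁ n≡2k   = k , inj₂ (cong suc n≡2k)
... | k , inj₂ n≡1+2k = suc k , inj₁ (cong suc n≡1+2k)

LowerBoundAt : ℕ → Set
LowerBoundAt n = Σ ℕ λ K → AtLeast n (InB n) K × BoundHolds 1 384 n K

oddSize-lowerBound : ∀ k → LowerBoundAt (suc (k * 2))
oddSize-lowerBound k = length (family k) , oddSize-atLeast k ,
  bound-from-count (suc (k * 2)) (length (family k)) (powUpper-odd k) (pow≤family k)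

evenSize-lowerBound : ∀ k → LowerBoundAt (suc (suc (k * 2)))
evenSize-lowerBound k = length (family k) , evenSize-atLeast k ,
  bound-from-count (suc (suc (k * 2))) (length (family k)) (powUpper-even k) (pow≤family k)

mainTheorem18 : Σ ℕ λ p → Σ ℕ λ q → Σ ℕ λ N →
    (∀ n → N ≤ n → Σ ℕ λ K → AtLeast n (InB n) K × BoundHolds (suc p) (suc q) n K)
mainTheorem18 = 0 , 383 , 1 , λ { zero () ; (suc n) _ → lowerBound n (parity n) }
  where
  lowerBound : ∀ n → (Σ ℕ λ k → n ≡ k * 2 ⊎ n ≡ suc (k * 2)) → LowerBoundAt (suc n)
  lowerBound n (k , inj₁ n≡2k)   = subst (LowerBoundAt ∘ suc) (sym n≡2k) (oddSize-lowerBound k)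
  lowerBound n (k , inj₂ n≡1+2k) = subst (LowerBoundAt ∘ suc) (sym n≡1+2k) (evenSize-lowerBound k)
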